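{- Let $G$ be a connected graph of order at least $3$. Then $\gamma_{mt}^{2}(G+K_1)=\gamma_t(G)$.
   Context: All graphs are finite, simple and undirected. $G+K_1$ is the join of $G$ with a single vertex, i.e. $G$ together with a new vertex adjacent to every vertex of $G$. A set $S \subseteq V(X)$ is a total dominating set of a graph $X$ if every vertex of $V(X)$ is adjacent to some vertex of $S$; $\gamma_t(X)$ is the minimum cardinality of a total dominating set of $X$. A non-empty $T\subseteq V(X)$ is a 2-movable total dominating set of a connected graph $X$ if $T$ is a total dominating set and for every pair $x,y\in T$, either $T\setminus\{x,y\}$ is a total dominating set of $X$, or there exist $u,v\in V(X)\setminus T$ such that $u$ is adjacent to $x$, $v$ is adjacent to $y$, and $(T\setminus\{x,y\})\cup\{u,v\}$ is a total dominating set of $X$. $\gamma_{mt}^2(X)$ is the minimum cardinality of a 2-movable total dominating set of $X$. -}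

module Defs where

open import Data.Nat using (ℕ; zero; suc; _≤_)
open import Data.Bool using (Bool; true; false; T)
open import Data.Fin using (Fin; zero; suc)
open import Data.Fin.Subset using (Subset; _∈_; _∉_; _∪_; _-_; ⁅_⁆; ∣_∣; Nonempty)
open import Data.Product using (Σ; ∃; ∃-syntax; _×_; _,_)
open import Data.Sum using (_⊎_)
open import Relation.Nullary using (¬_)
open import Relation.Binary.PropositionalEquality using (_≡_)

record Graph : Set where
  field
    n     : ℕ
    adj   : Fin n → Fin n → Bool
    sym   : ∀ u v → adj u v ≡ adj v u
    irrefl : ∀ v → adj v v ≡ false
open Graph public

Adj : (X : Graph) → Fin (n X) → Fin (n X) → Set
Adj X u v = T (adj X u v)

data Walk (X : Graph) : Fin (n X) → Fin (n X) → Set where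
  here : ∀ {u} → Walk X u u
  step : ∀ {u w v} → Adj X u w → Walk X w v → Walk X u v

Connected : Graph → Set
Connected X = ∀ u v → Walk X u v

-- The join G + K₁: the new vertex is zero, old vertex i becomes suc i.
joinAdj : ∀ {m} → (Fin m → Fin m → Bool) → Fin (suc m) → Fin (suc m) → Bool
joinAdj a zero    zero    = false
joinAdj a zero    (suc j) = true
joinAdj a (suc i) zero    = true
joinAdj a (suc i) (suc j) = a i j

joinSym : ∀ {m} (a : Fin m → Fin m → Bool) → (∀ u v → a u v ≡ a v u) →
          ∀ u v → joinAdj a u v ≡ joinAdj a v u
joinSym a s zero    zero    = _≡_.refl
joinSym a s zero    (suc j) = _≡_.refl
joinSym a s (suc i) zero    = _≡_.refl
joinSym a s (suc i) (suc j) = s i j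

joinIrrefl : ∀ {m} (a : Fin m → Fin m → Bool) → (∀ v → a v v ≡ false) →
             ∀ v → joinAdj a v v ≡ false
joinIrrefl a r zero    = _≡_.refl
joinIrrefl a r (suc i) = r i

_+K₁ : Graph → Graph
G +K₁ = record
  { n = suc (n G)
  ; adj = joinAdj (adj G)
  ; sym = joinSym (adj G) (sym G)
  ; irrefl = joinIrrefl (adj G) (irrefl G)
  }

IsTDS : (X : Graph) → Subset (n X) → Set
IsTDS X S = ∀ v → ∃[ u ] (u ∈ S × Adj X u v)

Is2MTDS : (X : Graph) → Subset (n X) → Set
Is2MTDS X T′ =
  Nonempty T′ × IsTDS X T′ ×
  (∀ x y → x ∈ T′ → y ∈ T′ → ¬ (x ≡ y) →
     IsTDS X ((T′ - x) - y)
     ⊎ ∃[ u ] ∃[ v ] (u ∉ T′ × v ∉ T′ × Adj X u x × Adj X v y ×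
                       IsTDS X ((((T′ - x) - y) ∪ ⁅ u ⁆) ∪ ⁅ v ⁆)))

IsMinCard : ∀ {m} → (Subset m → Set) → ℕ → Set
IsMinCard P k = (∃[ S ] (P S × ∣ S ∣ ≡ k)) × (∀ S → P S → k ≤ ∣ S ∣)

γt≡ : Graph → ℕ → Set
γt≡ X k = IsMinCard (IsTDS X) k

γmt2≡ : Graph → ℕ → Set
γmt2≡ X k = IsMinCard (Is2MTDS X) k

{-# OPTIONS --safe #-}
-- A total dominating set S of G stays total dominating in G + K₁, and it is
-- 2-movable there because the apex can always be one of the two replacement
-- vertices: it dominates every old vertex, so it only remains to keep a vertex
-- dominating the apex, namely a third vertex of S, or, if S = {x, y}, a
-- neighbour of x or y outside S, which exists since G is connected of order at
-- least 3. Conversely, moving the apex of a 2-movable total dominating set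
-- together with one of its neighbours in the set gives, without growing, a
-- total dominating set avoiding the apex, i.e. one of G.
module Submission where

open import Defs
open import Data.Nat using (ℕ; _≤_)
open import Data.Product using (∃-syntax; _×_; ∃; _,_)

open import Data.Nat.Base using (zero; suc; _+_; _<_; z≤n; s≤s)
open import Data.Nat.Properties
  using ( ≤-refl; ≤-reflexive; ≤-trans; +-monoʳ-≤; <⇒≤; ≮⇒≥; +-suc; +-comm; _≟_
        ; module ≤-Reasoning)
open import Data.Nat.Induction using (<-rec)
open import Data.Bool.Base using (T)
open import Data.Unit.Base using (tt)
open import Data.Empty using (⊥-elim)
open import Data.Fin.Base using (Fin; zero; suc; toℕ; fromℕ<; punchIn)
open import Data.Fin.Properties
  using (all?; any?; toℕ<n; toℕ-fromℕ<; punchInᵢ≢i) renaming (_≟_ to _≟ᶠ_)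
open import Data.Fin.Subset
  using (Subset; _∈_; _∉_; _∪_; _-_; ⁅_⁆; ∣_∣; ⊤; Nonempty; Empty; inside; outside)
open import Data.Fin.Subset.Properties
  using ( _∈?_; anySubset?; ∈⊤; x∈⁅x⁆; x∈⁅y⁆⇒x≡y; ∣⁅x⁆∣≡1; p⊆p∪q; q⊆p∪q; x∈p∪q⁻
        ; p─q⊆p; ∣p─q∣≤∣p∣; ∣p∣≤∣x∷p∣; x∈p∧x≢y⇒x∈p-y; x∈p⇒∣p-x∣<∣p∣; nonempty?)
open import Data.Vec.Base using (_∷_; []; here; there)
open import Data.Sum using (_⊎_; inj₁; inj₂; [_,_]′)
open import Function.Base using (_∘_)
open import Relation.Nullary using (yes; no)
open import Relation.Nullary.Decidable using (T?; _×-dec_)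
open import Relation.Unary using (Decidable)
open import Relation.Binary.PropositionalEquality
  using (_≡_; _≢_; refl; subst; cong; ≢-sym)
import Relation.Binary.PropositionalEquality as ≡

private
  variable
    m : ℕ

Least : (ℕ → Set) → Set
Least D = ∃[ j ] (D j × ∀ i → D i → j ≤ i)

least : ∀ {D : ℕ → Set} → Decidable D → ∀ k → D k → Least D
least {D} D? = <-rec (λ k → D k → Least D) search
  where
  search : ∀ k → (∀ {j} → j < k → D j → Least D) → D k → Least D
  search k rec Dk with any? (λ (j : Fin k) → D? (toℕ j))
  ... | yes (j , Dj) = rec (toℕ<n j) Dj
  ... | no none = k , Dk , λ i Di → ≮⇒≥ λ i<k →
    none (fromℕ< i<k , subst D (≡.sym (toℕ-fromℕ< i<k)) Di)

IsMinCard-exists : ∀ {P : Subset m → Set} → Decidable P → ∃ P → ∃ (IsMinCard P)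
IsMinCard-exists {P = P} P? (S , PS) with least D? ∣ S ∣ (S , PS , refl)
  where
  D : ℕ → Set
  D k = ∃[ S ] (P S × ∣ S ∣ ≡ k)
  D? : Decidable D
  D? k = anySubset? (λ S → P? S ×-dec (∣ S ∣ ≟ k))
... | k , witness , minimal = k , witness , λ S PS → minimal ∣ S ∣ (S , PS , refl)

other-vertex : 2 ≤ m → (v : Fin m) → ∃[ w ] (w ≢ v)
other-vertex (s≤s (s≤s _)) v = punchIn v zero , punchInᵢ≢i v zero

third-vertex : 3 ≤ m → (x y : Fin m) → ∃[ z ] (z ≢ x × z ≢ y)
third-vertex (s≤s (s≤s (s≤s _))) zero          zero          = suc zero , (λ ()) , (λ ())
third-vertex (s≤s (s≤s (s≤s _))) zero          (suc zero)    = suc (suc zero) , (λ ()) , (λ ())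
third-vertex (s≤s (s≤s (s≤s _))) zero          (suc (suc _)) = suc zero , (λ ()) , (λ ())
third-vertex (s≤s (s≤s (s≤s _))) (suc zero)    zero          = suc (suc zero) , (λ ()) , (λ ())
third-vertex (s≤s (s≤s (s≤s _))) (suc (suc _)) zero          = suc zero , (λ ()) , (λ ())
third-vertex (s≤s (s≤s (s≤s _))) (suc _)       (suc _)       = zero , (λ ()) , (λ ())

x∉p-x : ∀ (p : Subset m) x → x ∉ p - x
x∉p-x (_ ∷ p) zero    ()
x∉p-x (_ ∷ p) (suc x) (there x∈p-x) = x∉p-x p x x∈p-x

∣p∪q∣≤∣p∣+∣q∣ : ∀ (p q : Subset m) → ∣ p ∪ q ∣ ≤ ∣ p ∣ + ∣ q ∣
∣p∪q∣≤∣p∣+∣q∣ []            []            = z≤n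
∣p∪q∣≤∣p∣+∣q∣ (inside  ∷ p) (s ∷ q)       =
  s≤s (≤-trans (∣p∪q∣≤∣p∣+∣q∣ p q) (+-monoʳ-≤ ∣ p ∣ (∣p∣≤∣x∷p∣ s q)))
∣p∪q∣≤∣p∣+∣q∣ (outside ∷ p) (inside  ∷ q) =
  ≤-trans (s≤s (∣p∪q∣≤∣p∣+∣q∣ p q)) (≤-reflexive (≡.sym (+-suc ∣ p ∣ ∣ q ∣)))
∣p∪q∣≤∣p∣+∣q∣ (outside ∷ p) (outside ∷ q) = ∣p∪q∣≤∣p∣+∣q∣ p q

∣p∪⁅x⁆∣≤1+∣p∣ : ∀ (p : Subset m) x → ∣ p ∪ ⁅ x ⁆ ∣ ≤ suc ∣ p ∣
∣p∪⁅x⁆∣≤1+∣p∣ p x = begin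
  ∣ p ∪ ⁅ x ⁆ ∣        ≤⟨ ∣p∪q∣≤∣p∣+∣q∣ p ⁅ x ⁆ ⟩
  ∣ p ∣ + ∣ ⁅ x ⁆ ∣    ≡⟨ cong (∣ p ∣ +_) (∣⁅x⁆∣≡1 x) ⟩
  ∣ p ∣ + 1            ≡⟨ +-comm ∣ p ∣ 1 ⟩
  suc ∣ p ∣            ∎
  where open ≤-Reasoning

Empty[p-x-y]∧z∈p⇒z≡x⊎z≡y : ∀ {p : Subset m} {x y z} →
                            Empty (p - x - y) → z ∈ p → z ≡ x ⊎ z ≡ y
Empty[p-x-y]∧z∈p⇒z≡x⊎z≡y {x = x} {y} {z} empty z∈p with z ≟ᶠ x | z ≟ᶠ y
... | yes z≡x | _       = inj₁ z≡x
... | no  _   | yes z≡y = inj₂ z≡y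
... | no  z≢x | no  z≢y = ⊥-elim (empty (z , x∈p∧x≢y⇒x∈p-y (x∈p∧x≢y⇒x∈p-y z∈p z≢x) z≢y))

moved : Subset m → (x y u v : Fin m) → Subset m
moved p x y u v = ((p - x - y) ∪ ⁅ u ⁆) ∪ ⁅ v ⁆

p-x-y⊆moved : ∀ (p : Subset m) x y u v {z} → z ∈ p - x - y → z ∈ moved p x y u v
p-x-y⊆moved p x y u v z∈ = p⊆p∪q ⁅ v ⁆ (p⊆p∪q ⁅ u ⁆ z∈)

u∈moved : ∀ (p : Subset m) x y u v → u ∈ moved p x y u v
u∈moved p x y u v = p⊆p∪q ⁅ v ⁆ (q⊆p∪q (p - x - y) ⁅ u ⁆ (x∈⁅x⁆ u))

v∈moved : ∀ (p : Subset m) x y u v → v ∈ moved p x y u v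
v∈moved p x y u v = q⊆p∪q ((p - x - y) ∪ ⁅ u ⁆) ⁅ v ⁆ (x∈⁅x⁆ v)

x∉moved : ∀ {p : Subset m} {x y u v} → x ∈ p → u ∉ p → v ∉ p → x ∉ moved p x y u v
x∉moved {p = p} {x} {y} {u} {v} x∈p u∉p v∉p x∈moved with x∈p∪q⁻ _ ⁅ v ⁆ x∈moved
... | inj₂ x∈⁅v⁆ = v∉p (subst (_∈ p) (x∈⁅y⁆⇒x≡y v x∈⁅v⁆) x∈p)
... | inj₁ x∈p′ with x∈p∪q⁻ (p - x - y) ⁅ u ⁆ x∈p′
...   | inj₂ x∈⁅u⁆ = u∉p (subst (_∈ p) (x∈⁅y⁆⇒x≡y u x∈⁅u⁆) x∈p)
...   | inj₁ x∈p-x-y = x∉p-x p x (p─q⊆p (p - x) ⁅ y ⁆ x∈p-x-y)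

∣moved∣≤∣p∣ : ∀ {p : Subset m} {x y} u v → x ∈ p → y ∈ p → x ≢ y →
              ∣ moved p x y u v ∣ ≤ ∣ p ∣
∣moved∣≤∣p∣ {p = p} {x} {y} u v x∈p y∈p x≢y = begin
  ∣ moved p x y u v ∣               ≤⟨ ∣p∪⁅x⁆∣≤1+∣p∣ ((p - x - y) ∪ ⁅ u ⁆) v ⟩
  suc ∣ (p - x - y) ∪ ⁅ u ⁆ ∣       ≤⟨ s≤s (∣p∪⁅x⁆∣≤1+∣p∣ (p - x - y) u) ⟩
  suc (suc ∣ p - x - y ∣)           ≤⟨ s≤s (x∈p⇒∣p-x∣<∣p∣ (x∈p∧x≢y⇒x∈p-y y∈p (≢-sym x≢y))) ⟩
  suc ∣ p - x ∣                     ≤⟨ x∈p⇒∣p-x∣<∣p∣ x∈p ⟩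
  ∣ p ∣                             ∎
  where open ≤-Reasoning

Movable : (X : Graph) → Subset (n X) → (x y : Fin (n X)) → Set
Movable X p x y =
  IsTDS X (p - x - y) ⊎
  ∃[ u ] ∃[ v ] (u ∉ p × v ∉ p × Adj X u x × Adj X v y × IsTDS X (moved p x y u v))

module _ {X : Graph} where

  IsTDS? : Decidable (IsTDS X)
  IsTDS? p = all? λ v → any? λ u → (u ∈? p) ×-dec T? (adj X u v)

  Adj-sym : ∀ {u v} → Adj X u v → Adj X v u
  Adj-sym {u} {v} = subst T (Graph.sym X u v)

  Adj⇒≢ : ∀ {u v} → Adj X u v → u ≢ v
  Adj⇒≢ {u} uu refl = subst T (irrefl X u) uu

  IsTDS⇒Nonempty : ∀ {p} → Fin (n X) → IsTDS X p → Nonempty p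
  IsTDS⇒Nonempty v dom with dom v
  ... | u , u∈p , _ = u , u∈p

  ⊤-isTDS : Connected X → 2 ≤ n X → IsTDS X ⊤
  ⊤-isTDS connected 2≤n v with other-vertex 2≤n v
  ... | w , w≢v with connected v w
  ...   | here = ⊥-elim (w≢v refl)
  ...   | step vu _ = _ , ∈⊤ , Adj-sym vu

  boundary-edge : ∀ {p a z} → Walk X a z → a ∈ p → z ∉ p →
                  ∃[ b ] ∃[ w ] (b ∈ p × w ∉ p × Adj X b w)
  boundary-edge             here             a∈p z∉p = ⊥-elim (z∉p a∈p)
  boundary-edge {p} (step {w = w} aw walk) a∈p z∉p with w ∈? p
  ... | yes w∈p = boundary-edge walk w∈p z∉p
  ... | no  w∉p = _ , w , a∈p , w∉p , aw

  outside-neighbour : Connected X → 3 ≤ n X → ∀ {p x y} → x ∈ p → Empty (p - x - y) →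
                      ∃[ w ] (w ∉ p × (Adj X x w ⊎ Adj X y w))
  outside-neighbour connected 3≤n {x = x} {y} x∈p empty with third-vertex 3≤n x y
  ... | z , z≢x , z≢y
      with boundary-edge (connected x z) x∈p ([ z≢x , z≢y ]′ ∘ Empty[p-x-y]∧z∈p⇒z≡x⊎z≡y empty)
  ...   | b , w , b∈p , w∉p , bw with Empty[p-x-y]∧z∈p⇒z≡x⊎z≡y empty b∈p
  ...     | inj₁ refl = w , w∉p , inj₁ bw
  ...     | inj₂ refl = w , w∉p , inj₂ bw

  Is2MTDS⇒avoiding-TDS : ∀ {p} → Is2MTDS X p → ∀ x →
                         ∃[ q ] (IsTDS X q × x ∉ q × ∣ q ∣ ≤ ∣ p ∣)
  Is2MTDS⇒avoiding-TDS {p} (_ , dom , movable) x with x ∈? p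
  ... | no x∉p = p , dom , x∉p , ≤-refl
  ... | yes x∈p with dom x
  ...   | y , y∈p , yx with movable x y x∈p y∈p (≢-sym (Adj⇒≢ yx))
  ...     | inj₁ dom′ =
    p - x - y , dom′ , (λ x∈ → x∉p-x p x (p─q⊆p (p - x) ⁅ y ⁆ x∈)) ,
    ≤-trans (∣p─q∣≤∣p∣ (p - x) ⁅ y ⁆) (∣p─q∣≤∣p∣ p ⁅ x ⁆)
  ...     | inj₂ (u , v , u∉p , v∉p , _ , _ , dom′) =
    moved p x y u v , dom′ , x∉moved x∈p u∉p v∉p ,
    ∣moved∣≤∣p∣ u v x∈p y∈p (≢-sym (Adj⇒≢ yx))

module _ (G : Graph) where

  IsTDS-+K₁⁻ : ∀ {p} → IsTDS (G +K₁) (outside ∷ p) → IsTDS G p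
  IsTDS-+K₁⁻ dom v with dom (suc v)
  ... | suc u , there u∈p , uv = u , u∈p , uv

  IsTDS-+K₁⁺ : ∀ {p} → IsTDS G p → Nonempty p → IsTDS (G +K₁) (outside ∷ p)
  IsTDS-+K₁⁺ _   (u , u∈p) zero    = suc u , there u∈p , tt
  IsTDS-+K₁⁺ dom _         (suc v) with dom v
  ... | u , u∈p , uv = suc u , there u∈p , uv

  apex∈⇒IsTDS-+K₁ : ∀ {p z} → zero ∈ p → suc z ∈ p → IsTDS (G +K₁) p
  apex∈⇒IsTDS-+K₁ {z = z} _   z∈p zero    = suc z , z∈p , tt
  apex∈⇒IsTDS-+K₁         0∈p _   (suc v) = zero , 0∈p , tt

  Movable-+K₁ : Connected G → 3 ≤ n G → ∀ {p x y} → x ∈ p →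
                Movable (G +K₁) (outside ∷ p) (suc x) (suc y)
  Movable-+K₁ connected 3≤n {p} {x} {y} x∈p with nonempty? (p - x - y)
  ... | yes (z , z∈p-x-y) =
    inj₂ (zero , zero , (λ ()) , (λ ()) , tt , tt ,
          apex∈⇒IsTDS-+K₁ (u∈moved (outside ∷ p) (suc x) (suc y) zero zero)
                          (p-x-y⊆moved (outside ∷ p) (suc x) (suc y) zero zero (there z∈p-x-y)))
  ... | no empty with outside-neighbour connected 3≤n x∈p empty
  ...   | w , w∉p , inj₁ xw =
    inj₂ (suc w , zero , (λ { (there w∈p) → w∉p w∈p }) , (λ ()) , Adj-sym {G} xw , tt ,
          apex∈⇒IsTDS-+K₁ (v∈moved (outside ∷ p) (suc x) (suc y) (suc w) zero)
                          (u∈moved (outside ∷ p) (suc x) (suc y) (suc w) zero))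
  ...   | w , w∉p , inj₂ yw =
    inj₂ (zero , suc w , (λ ()) , (λ { (there w∈p) → w∉p w∈p }) , tt , Adj-sym {G} yw ,
          apex∈⇒IsTDS-+K₁ (u∈moved (outside ∷ p) (suc x) (suc y) zero (suc w))
                          (v∈moved (outside ∷ p) (suc x) (suc y) zero (suc w)))

  IsTDS⇒Is2MTDS-+K₁ : Connected G → 3 ≤ n G → ∀ {p} → IsTDS G p →
                      Is2MTDS (G +K₁) (outside ∷ p)
  IsTDS⇒Is2MTDS-+K₁ connected 3≤n {p} dom = IsTDS⇒Nonempty {G +K₁} zero dom′ , dom′ , movable
    where
    dom′ : IsTDS (G +K₁) (outside ∷ p)
    dom′ = IsTDS-+K₁⁺ dom (IsTDS⇒Nonempty {G} (fromℕ< 3≤n) dom)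
    movable : ∀ x y → x ∈ outside ∷ p → y ∈ outside ∷ p → x ≢ y →
              Movable (G +K₁) (outside ∷ p) x y
    movable (suc x) (suc y) (there x∈p) _ _ = Movable-+K₁ connected 3≤n x∈p

  Is2MTDS-+K₁⇒IsTDS : ∀ {q} → Is2MTDS (G +K₁) q → ∃[ p ] (IsTDS G p × ∣ p ∣ ≤ ∣ q ∣)
  Is2MTDS-+K₁⇒IsTDS mtds with Is2MTDS⇒avoiding-TDS {G +K₁} mtds zero
  ... | inside  ∷ _ , _   , 0∉q′ , _          = ⊥-elim (0∉q′ here)
  ... | outside ∷ p , dom , _    , ∣q′∣≤∣q∣ = p , IsTDS-+K₁⁻ dom , ∣q′∣≤∣q∣

theorem3p4 : (G : Graph) → Connected G → 3 ≤ n G →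
    ∃[ k ] (γt≡ G k × γmt2≡ (G +K₁) k)
theorem3p4 G connected 3≤n with IsMinCard-exists (IsTDS? {G}) (⊤ , ⊤-isTDS connected (<⇒≤ 3≤n))
... | k , (p , dom , ∣p∣≡k) , minimal =
  k , ((p , dom , ∣p∣≡k) , minimal) ,
  ((outside ∷ p , IsTDS⇒Is2MTDS-+K₁ G connected 3≤n dom , ∣p∣≡k) , bound)
  where
  bound : ∀ q → Is2MTDS (G +K₁) q → k ≤ ∣ q ∣
  bound q mtds with Is2MTDS-+K₁⇒IsTDS G mtds
  ... | p′ , dom′ , ∣p′∣≤∣q∣ = ≤-trans (minimal p′ dom′) ∣p′∣≤∣q∣
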